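{- Let $G=(V,E)$ be a finite undirected graph and $T$ a rooted spanning tree of $G$ with root $r_T$. Let $S=\{x_1,\dots,x_k\}\subset V\setminus\{r_T\}$ with $|S|=k\ge3$. Suppose: (1) there exist $x,y\in S$ with $x^{\downarrow T}\cap y^{\downarrow T}\neq\emptyset$; (2) there exists $x'\in S$ such that $y'\in x'^{\downarrow T}$ for all $y'\in S$; (3) there exists $x''\in S$ such that $y''\in x''^{\uparrow T}$ for all $y''\in S$. Then $\gamma(x_1^{\downarrow T},\dots,x_k^{\downarrow T})=\gamma(p^{\downarrow T},q^{\downarrow T})$, where $p=\operatorname{argmax}_{x\in S}\ell_T(x)$ and $q=\operatorname{argmin}_{x\in S}\ell_T(x)$.
   Context: $v^{\downarrow T}$ is the set of descendants of $v$ in $T$, including $v$. $v^{\uparrow T}$ is the set of vertices on the tree path from $r_T$ to $v$ (including both). $\ell_T(v)$ is the distance of $v$ from $r_T$ in $T$. For $B\subseteq V$, $\delta(B)$ is the set of edges of $G$ with exactly one endpoint in $B$. For vertex sets $A_1,\dots,A_i\subseteq V$, $\gamma(A_1,\dots,A_i)=|\delta(A_1)\cap\cdots\cap\delta(A_i)|$. -}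

module Defs where

open import Data.Nat using (ℕ; zero; suc; _≤_; _<ᵇ_)
open import Data.Nat.ListAction using (sum)
open import Data.Bool using (Bool; true; false; _∧_; _xor_; if_then_else_; T)
open import Data.Fin using (Fin; toℕ)
open import Data.Fin.Properties using (_≟_)
open import Data.List using (List; map; upTo; allFin)
open import Data.Bool.ListAction using (all; any)
open import Data.Product using (∃-syntax; _×_)
open import Relation.Binary.PropositionalEquality using (_≡_; _≢_)
open import Relation.Nullary.Decidable using (⌊_⌋)

record Graph (n : ℕ) : Set where
  field
    adj    : Fin n → Fin n → Bool
    adj-sym   : ∀ u v → adj u v ≡ adj v u
    adj-irrefl : ∀ v → adj v v ≡ false
open Graph public

iter : {A : Set} → (A → A) → ℕ → A → A
iter f zero    a = a
iter f (suc k) a = f (iter f k a)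

-- A rooted spanning tree of G: every non-root vertex v has a parent
-- which is a G-neighbour (tree edge {v, parent v}), and following parents
-- from any vertex reaches the root (acyclicity/connectivity).
record RootedSpanningTree {n : ℕ} (G : Graph n) : Set where
  field
    root         : Fin n
    parent       : Fin n → Fin n
    parent-root  : parent root ≡ root
    parent-edge  : ∀ v → v ≢ root → T (adj G v (parent v))
    reaches-root : ∀ v → ∃[ k ] iter parent k v ≡ root
open RootedSpanningTree public

module _ {n : ℕ} {G : Graph n} (Tr : RootedSpanningTree G) where

  -- u ∈ v^{↓T}  (u is a descendant of v, including u = v);
  -- equivalently v ∈ u^{↑T} (v lies on the tree path from the root to u).
  Desc : Fin n → Fin n → Set
  Desc u v = ∃[ k ] iter (parent Tr) k u ≡ v

  -- Boolean characteristic function of v^{↓T}. Tree paths have fewer than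
  -- n edges, so searching k ∈ {0,…,n} is the same as searching all k.
  descSet : Fin n → (Fin n → Bool)
  descSet v u = any (λ k → ⌊ iter (parent Tr) k u ≟ v ⌋) (upTo (suc n))

  Level : Fin n → ℕ → Set
  Level v k = (iter (parent Tr) k v ≡ root Tr)
            × (∀ j → iter (parent Tr) j v ≡ root Tr → k ≤ j)

-- γ(A_1,…,A_i) = |δ(A_1) ∩ … ∩ δ(A_i)|: number of edges {u,v} of G
-- (counted once, with toℕ u < toℕ v) having exactly one endpoint in each A_j.
γ : {n : ℕ} → Graph n → List (Fin n → Bool) → ℕ
γ {n} G As =
  sum (map (λ u → sum (map (λ v →
    if (toℕ u <ᵇ toℕ v) ∧ adj G u v ∧ all (λ A → A u xor A v) As
    then 1 else 0) (allFin n))) (allFin n))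

-- The hypotheses place every x i on the tree path from the root to a common
-- vertex, so the subtrees x i ^↓ form a chain under inclusion, with x p ^↓ the
-- smallest (p is deepest) and x q ^↓ the largest (q is shallowest). An edge
-- with exactly one endpoint in the innermost and in the outermost set of a
-- chain has exactly one endpoint in every set in between, so intersecting the
-- cuts of the whole chain gives the same edge set as intersecting the two
-- extreme cuts.
module Submission where

open import Defs
open import Data.Nat using (ℕ; _≤_; _≥_)
open import Data.Fin using (Fin)
open import Data.List using (_∷_; []; map; allFin)
open import Data.Product using (∃-syntax; _×_)
open import Function.Definitions using (Injective)
open import Relation.Binary.PropositionalEquality using (_≡_; _≢_)

open import Data.Nat using (zero; suc; _+_; _∸_; _<_; _<ᵇ_; z≤n; s≤s; s≤s⁻¹; _≤?_)
open import Data.Nat.Properties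
  using (+-monoʳ-<; +-monoˡ-≤; m∸n+n≡m; n<1+n;
         n≤0⇒n≡0; ≤-trans; <⇒≤; <-≤-trans; ≰⇒>; ≤-reflexive)
open import Data.Nat.Induction using (<-wellFounded)
open import Data.Nat.ListAction using (sum)
open import Data.Fin using (toℕ)
open import Data.Fin.Properties using (_≟_; toℕ<n; pigeonhole)
open import Data.Bool using (Bool; true; false; T; _∧_; _xor_; if_then_else_)
open import Data.Bool.ListAction using (all; any; and)
open import Data.List using (List; upTo)
open import Data.List.Properties using (map-cong; map-∘)
open import Data.List.Membership.Propositional using (_∈_; lose)
open import Data.List.Membership.Propositional.Properties using (∈-upTo⁺; ∈-allFin)
open import Data.List.Relation.Unary.All as All using (_∷_; [])
open import Data.List.Relation.Unary.All.Properties using (all⁺; all⁻)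
open import Data.List.Relation.Unary.Any using (satisfied)
open import Data.List.Relation.Unary.Any.Properties using (any⁺; any⁻)
open import Data.Product using (_,_)
open import Data.Sum using (_⊎_; inj₁; inj₂)
open import Data.Empty using (⊥-elim)
open import Induction.WellFounded using (Acc; acc)
open import Relation.Nullary using (yes; no; contradiction)
open import Relation.Nullary.Decidable using (toWitness; fromWitness)
open import Relation.Unary using (Decidable)
open import Relation.Binary.PropositionalEquality using (refl; sym; trans; cong; module ≡-Reasoning)

∃-least : {P : ℕ → Set} → Decidable P → ∀ {j} → P j →
          ∃[ l ] P l × (∀ j → P j → l ≤ j)
∃-least P? {zero} p0 = 0 , p0 , λ _ _ → z≤n
∃-least {P} P? {suc j} pj with P? 0
... | yes p0 = 0 , p0 , λ _ _ → z≤n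
... | no ¬p0 =
  let l , pl , l-least = ∃-least {P = λ i → P (suc i)} (λ i → P? (suc i)) pj in
  suc l , pl , λ where
    zero    p0  → contradiction p0 ¬p0
    (suc i) psi → s≤s (l-least i psi)

m+n≤m⇒n≡0 : ∀ m {n} → m + n ≤ m → n ≡ 0
m+n≤m⇒n≡0 zero    n≤0        = n≤0⇒n≡0 n≤0
m+n≤m⇒n≡0 (suc m) (s≤s m+n≤m) = m+n≤m⇒n≡0 m m+n≤m

T-injective : ∀ {a b} → (T a → T b) → (T b → T a) → a ≡ b
T-injective {false} {false} _ _ = refl
T-injective {false} {true}  _ b⇒a = ⊥-elim (b⇒a _)
T-injective {true}  {false} a⇒b _ = ⊥-elim (a⇒b _)
T-injective {true}  {true}  _ _ = refl

all-≡-all-pair : {A : Set} (P : A → Bool) {xs : List A} {p q : A} →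
                 p ∈ xs → q ∈ xs → (∀ {x} → x ∈ xs → T (P p) → T (P q) → T (P x)) →
                 all P xs ≡ all P (p ∷ q ∷ [])
all-≡-all-pair P {xs} {p} {q} p∈xs q∈xs pq⇒x = T-injective to from
  where
  to : T (all P xs) → T (all P (p ∷ q ∷ []))
  to Pxs = let all-P = all⁺ P xs Pxs in all⁻ P (All.lookup all-P p∈xs ∷ All.lookup all-P q∈xs ∷ [])
  from : T (all P (p ∷ q ∷ [])) → T (all P xs)
  from Ppq with Pp ∷ Pq ∷ [] ← all⁺ P (_ ∷ _ ∷ []) Ppq =
    all⁻ P (All.tabulate λ x∈xs → pq⇒x x∈xs Pp Pq)

separates : {V : Set} → V → V → (V → Bool) → Bool
separates u v A = A u xor A v

xor-between : ∀ a b c a′ b′ c′ → (T a → T b) → (T b → T c) → (T a′ → T b′) → (T b′ → T c′) →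
              T (a xor a′) → T (c xor c′) → T (b xor b′)
xor-between a     true  c     a′    false c′    _   _   _     _     _ _  = _
xor-between a     false c     a′    true  c′    _   _   _     _     _ _  = _
xor-between a     true  true  a′    true  true  _   _   _     _     _ ()
xor-between a     true  false a′    true  c′    _   b⇒c _     _     _ _  = ⊥-elim (b⇒c _)
xor-between a     true  c     a′    true  false _   _   _     b′⇒c′ _ _  = ⊥-elim (b′⇒c′ _)
xor-between false false c     false false c′    _   _   _     _     () _
xor-between true  false c     a′    false c′    a⇒b _   _     _     _ _  = ⊥-elim (a⇒b _)
xor-between a     false c     true  false c′    _   _   a′⇒b′ _     _ _  = ⊥-elim (a′⇒b′ _)

separates-between : {V : Set} {A B C : V → Bool} (u v : V) →
                    (∀ w → T (A w) → T (B w)) → (∀ w → T (B w) → T (C w)) →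
                    T (separates u v A) → T (separates u v C) → T (separates u v B)
separates-between {A = A} {B} {C} u v A⊆B B⊆C =
  xor-between (A u) (B u) (C u) (A v) (B v) (C v) (A⊆B u) (B⊆C u) (A⊆B v) (B⊆C v)

γ-cong : ∀ {n} (G : Graph n) {As Bs : List (Fin n → Bool)} →
         (∀ u v → all (separates u v) As ≡ all (separates u v) Bs) → γ G As ≡ γ G Bs
γ-cong {n} G same-cut = cong sum (map-cong (λ u → cong sum (map-cong (λ v →
  cong (λ b → if (toℕ u <ᵇ toℕ v) ∧ adj G u v ∧ b then 1 else 0) (same-cut u v))
  (allFin n))) (allFin n))

module _ {A : Set} (f : A → A) where

  iter-+ : ∀ m k a → iter f (m + k) a ≡ iter f m (iter f k a)
  iter-+ zero    k a = refl
  iter-+ (suc m) k a = cong f (iter-+ m k a)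

  iter-fixedPoint : ∀ {r} → f r ≡ r → ∀ m → iter f m r ≡ r
  iter-fixedPoint fr≡r zero    = refl
  iter-fixedPoint fr≡r (suc m) = trans (cong f (iter-fixedPoint fr≡r m)) fr≡r

  iter-shift : ∀ {i j x} d → iter f i x ≡ iter f j x → iter f (d + i) x ≡ iter f (d + j) x
  iter-shift {i} {j} {x} d fi≡fj = begin
    iter f (d + i) x             ≡⟨ iter-+ d i x ⟩
    iter f d (iter f i x)        ≡⟨ cong (iter f d) fi≡fj ⟩
    iter f d (iter f j x)        ≡⟨ iter-+ d j x ⟨
    iter f (d + j) x             ∎
    where open ≡-Reasoning

  iter-∸ : ∀ {a b x y z} → a ≤ b → iter f a x ≡ y → iter f b x ≡ z → iter f (b ∸ a) y ≡ z
  iter-∸ {a} {b} {x} {y} {z} a≤b fa≡y fb≡z = begin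
    iter f (b ∸ a) y             ≡⟨ cong (iter f (b ∸ a)) fa≡y ⟨
    iter f (b ∸ a) (iter f a x)  ≡⟨ iter-+ (b ∸ a) a x ⟨
    iter f (b ∸ a + a) x         ≡⟨ cong (λ c → iter f c x) (m∸n+n≡m a≤b) ⟩
    iter f b x                   ≡⟨ fb≡z ⟩
    z                            ∎
    where open ≡-Reasoning

  iter-≤-fixedPoint : ∀ {r a b x} → f r ≡ r → a ≤ b → iter f a x ≡ r → iter f b x ≡ r
  iter-≤-fixedPoint {a = a} {b} fr≡r a≤b fa≡r =
    trans (sym (iter-∸ a≤b fa≡r refl)) (iter-fixedPoint fr≡r (b ∸ a))

-- Pigeonhole on the n + 1 iterates x, f x, …, fⁿ x: two of them coincide, so
-- any longer orbit segment can be cut short.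
iter-within : ∀ {n} (f : Fin n → Fin n) x t → ∃[ s ] s ≤ n × iter f s x ≡ iter f t x
iter-within {n} f x t = go t (<-wellFounded t)
  where
  go : ∀ t → Acc _<_ t → ∃[ s ] s ≤ n × iter f s x ≡ iter f t x
  go t (acc shorter) with t ≤? n
  ... | yes t≤n = t , t≤n , refl
  ... | no t≰n with i , j , i<j , fi≡fj ← pigeonhole (n<1+n n) (λ i → iter f (toℕ i) x) =
    let s , s≤n , fs≡ft′ = go t′ (shorter t′<t) in s , s≤n , trans fs≡ft′ ft′≡ft
    where
    j≤t : toℕ j ≤ t
    j≤t = ≤-trans (s≤s⁻¹ (toℕ<n j)) (<⇒≤ (≰⇒> t≰n))
    t′ : ℕ
    t′ = t ∸ toℕ j + toℕ i
    t+ : t ∸ toℕ j + toℕ j ≡ t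
    t+ = m∸n+n≡m j≤t
    t′<t : t′ < t
    t′<t = <-≤-trans (+-monoʳ-< (t ∸ toℕ j) i<j) (≤-reflexive t+)
    ft′≡ft : iter f t′ x ≡ iter f t x
    ft′≡ft = trans (iter-shift f (t ∸ toℕ j) fi≡fj) (cong (λ c → iter f c x) t+)

module _ {n : ℕ} {G : Graph n} (Tr : RootedSpanningTree G) where

  Desc-trans : ∀ {u v w} → Desc Tr u v → Desc Tr v w → Desc Tr u w
  Desc-trans {u} (a , fa≡v) (b , fb≡w) =
    b + a , trans (iter-+ (parent Tr) b a u) (trans (cong (iter (parent Tr) b) fa≡v) fb≡w)

  Desc-total : ∀ {c u w} → Desc Tr c u → Desc Tr c w → Desc Tr u w ⊎ Desc Tr w u
  Desc-total (a , fa≡u) (b , fb≡w) with a ≤? b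
  ... | yes a≤b = inj₁ (b ∸ a , iter-∸ (parent Tr) a≤b fa≡u fb≡w)
  ... | no a≰b  = inj₂ (a ∸ b , iter-∸ (parent Tr) (<⇒≤ (≰⇒> a≰b)) fb≡w fa≡u)

  descSet-sound : ∀ {u v} → T (descSet Tr v u) → Desc Tr u v
  descSet-sound u∈v↓ with k , fk≡v ← satisfied (any⁻ _ (upTo (suc n)) u∈v↓) =
    k , toWitness fk≡v

  descSet-complete : ∀ {u v} → Desc Tr u v → T (descSet Tr v u)
  descSet-complete {u} (t , ft≡v) with s , s≤n , fs≡ft ← iter-within (parent Tr) u t =
    any⁺ _ (lose (∈-upTo⁺ (s≤s s≤n)) (fromWitness (trans fs≡ft ft≡v)))

  descSet-⊆ : ∀ {u v} → Desc Tr u v → ∀ w → T (descSet Tr u w) → T (descSet Tr v w)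
  descSet-⊆ u↓v w w∈u↓ = descSet-complete (Desc-trans (descSet-sound w∈u↓) u↓v)

  level : ∀ v → ∃[ l ] Level Tr v l
  level v with j , fj≡r ← reaches-root Tr v =
    ∃-least (λ i → iter (parent Tr) i v ≟ root Tr) {j} fj≡r

  level-ancestor : ∀ {m v w lv lw} → iter (parent Tr) m v ≡ w → w ≢ root Tr →
                   Level Tr v lv → Level Tr w lw → lw + m ≤ lv
  level-ancestor {m} {lv = lv} {lw} fm≡w w≢r (flv≡r , _) (_ , lw-least) with m ≤? lv
  ... | no m≰lv =
    contradiction (trans (sym fm≡w)
      (iter-≤-fixedPoint (parent Tr) (parent-root Tr) (<⇒≤ (≰⇒> m≰lv)) flv≡r)) w≢r
  ... | yes m≤lv = begin
      lw + m          ≤⟨ +-monoˡ-≤ m (lw-least (lv ∸ m) (iter-∸ (parent Tr) m≤lv fm≡w flv≡r)) ⟩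
      lv ∸ m + m      ≡⟨ m∸n+n≡m m≤lv ⟩
      lv              ∎
    where open Data.Nat.Properties.≤-Reasoning

  Desc-of-deeper : ∀ {c u w lu lw} → Desc Tr c u → Desc Tr c w → u ≢ root Tr →
                   Level Tr u lu → Level Tr w lw → lw ≤ lu → Desc Tr u w
  Desc-of-deeper {lu = lu} c↓u c↓w u≢r Lu Lw lw≤lu with Desc-total c↓u c↓w
  ... | inj₁ u↓w = u↓w
  ... | inj₂ (m , fm≡u) with refl ← m+n≤m⇒n≡0 lu {m} (≤-trans (level-ancestor fm≡u u≢r Lw Lu) lw≤lu) =
    0 , sym fm≡u

-- Only hypothesis (3), a common descendant of all x i, is needed: (1) follows
-- from it.
proposition4p5 : {n : ℕ} (G : Graph n) (Tr : RootedSpanningTree G)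
    (k : ℕ) (x : Fin k → Fin n) →
    Injective _≡_ _≡_ x →
    k ≥ 3 →
    (∀ i → x i ≢ root Tr) →
    (∃[ i ] ∃[ j ] ∃[ w ] (Desc Tr w (x i) × Desc Tr w (x j))) →
    (∃[ i ] (∀ j → Desc Tr (x j) (x i))) →
    (∃[ i ] (∀ j → Desc Tr (x i) (x j))) →
    (p q : Fin k) (lp lq : ℕ) →
    Level Tr (x p) lp →
    Level Tr (x q) lq →
    (∀ i l → Level Tr (x i) l → l ≤ lp) →
    (∀ i l → Level Tr (x i) l → lq ≤ l) →
    γ G (map (λ i → descSet Tr (x i)) (allFin k))
      ≡ γ G (descSet Tr (x p) ∷ descSet Tr (x q) ∷ [])
proposition4p5 {n} G Tr k x _ _ x≢root _ _ (_ , below) p q lp lq Lp Lq lp-max lq-min =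
  γ-cong G {map ↓x (allFin k)} {↓x p ∷ ↓x q ∷ []} λ u v →
    trans (cong and (sym (map-∘ {g = separates u v} (allFin k))))
      (all-≡-all-pair (λ i → separates u v (↓x i)) (∈-allFin p) (∈-allFin q)
        λ {i} _ → separates-between u v (descSet-⊆ Tr (p-below i)) (descSet-⊆ Tr (q-above i)))
  where
  ↓x : Fin k → Fin n → Bool
  ↓x i = descSet Tr (x i)
  p-below : ∀ i → Desc Tr (x p) (x i)
  p-below i = let li , Li = level Tr (x i) in
    Desc-of-deeper Tr (below p) (below i) (x≢root p) Lp Li (lp-max i li Li)
  q-above : ∀ i → Desc Tr (x i) (x q)
  q-above i = let li , Li = level Tr (x i) in
    Desc-of-deeper Tr (below i) (below q) (x≢root i) Li Lq (lq-min i li Li)
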